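{- Let $t$ be a positive integer and let $W_t$ be the graph constructed below. Every finite induced subgraph of $W_t$ has clique number at most $t+1$.
   Context: A trigraph is a triple $(V,E_B,E_R)$ of a vertex set and two disjoint sets of black and red edges; its total graph is $(V, E_B\cup E_R)$ and its real graph is $(V,E_B)$. Construction of the trigraph $G_t$ and rooted tree $T_t$ (same vertex set): the vertex set is partitioned into finite layers $L_0, L_1, \dots$, each inducing a path of black edges ordered left to right. $L_0$ is a single vertex, the root of $T_t$. Given $L_{\le i} = L_0\cup\dots\cup L_i$, the layer $L_{i+1}$ is built as follows: for each $u\in L_i$ taken from left to right, let $N^\uparrow[u] := (N_{\mathcal T(G_t)}(u)\cap L_{\le i-1})\cup\{u\}$ (neighbours in the total graph in earlier layers, plus $u$); for every ordered pair $(B,R)$ of disjoint subsets of $N^\uparrow[u]$ with $|B\cup R|\le t$, append a new vertex $v_{B,R}$ at the right end of $L_{i+1}$ joined by a black edge to the previous rightmost vertex of $L_{i+1}$ (if any), make $v_{B,R}$ a child of $u$ in $T_t$, and add a black edge from $v_{B,R}$ to every vertex of $B$ and a red edge from $v_{B,R}$ to every vertex of $R$. $W_t$ is the real graph of $G_t$. -}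

module Defs where

open import Data.Nat using (ℕ; zero; suc; _≡ᵇ_; _⊔_; _<_)
open import Data.Bool using (Bool; true; false; _∧_; _∨_; if_then_else_)
open import Data.List using (List; []; _∷_; _++_; [_]; map; concat; upTo; length)
open import Data.Bool.ListAction using (any)
open import Data.Maybe using (Maybe; just; nothing; maybe; fromMaybe)
open import Data.Product using (_×_; _,_; proj₁; proj₂)
open import Data.List.Membership.Propositional using (_∈_)
open import Data.List.Relation.Unary.All using (All)
open import Data.List.Relation.Unary.Unique.Propositional using (Unique)
open import Relation.Binary.PropositionalEquality using (_≡_; _≢_)

-- A vertex of G_t is coded by (layer index i , position p in L_i from the left, 0-based).
Vtx : Set
Vtx = ℕ × ℕ

layerOfV : Vtx → ℕ
layerOfV = proj₁

-- Data stored for a vertex v_{B,R}: position of its parent u in the previous layer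
-- (the tree T_t), its black set B and its red set R.
record VInfo : Set where
  constructor vinfo
  field
    parent : ℕ
    blk    : List Vtx
    red    : List Vtx
open VInfo public

-- The root (no parent, no B, R; the parent field is irrelevant).
rootInfo : VInfo
rootInfo = vinfo 0 [] []

-- Layers L_0, ..., L_i, the j-th entry being L_j listed from left to right.
Layers : Set
Layers = List (List VInfo)

eqV : Vtx → Vtx → Bool
eqV (i , p) (j , q) = (i ≡ᵇ j) ∧ (p ≡ᵇ q)

elemB : Vtx → List Vtx → Bool
elemB x = any (eqV x)

filterB : {A : Set} → (A → Bool) → List A → List A
filterB f [] = []
filterB f (x ∷ xs) = if f x then x ∷ filterB f xs else filterB f xs

lookupM : {A : Set} → List A → ℕ → Maybe A
lookupM [] _ = nothing
lookupM (x ∷ xs) zero = just x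
lookupM (x ∷ xs) (suc n) = lookupM xs n

layerIn : Layers → ℕ → List VInfo
layerIn Ls j = fromMaybe [] (lookupM Ls j)

infoOf : Layers → Vtx → Maybe VInfo
infoOf Ls (i , p) = lookupM (layerIn Ls i) p

consecutive : Vtx → Vtx → Bool
consecutive (i , p) (j , q) = (i ≡ᵇ j) ∧ ((suc p ≡ᵇ q) ∨ (suc q ≡ᵇ p))

-- x was created with an edge (black or red) to y
refersTot : Layers → Vtx → Vtx → Bool
refersTot Ls x y = maybe (λ I → elemB y (blk I ++ red I)) false (infoOf Ls x)

refersBlk : Layers → Vtx → Vtx → Bool
refersBlk Ls x y = maybe (λ I → elemB y (blk I)) false (infoOf Ls x)

-- adjacency in the total graph / the real graph of the trigraph built so far
totalAdj : Layers → Vtx → Vtx → Bool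
totalAdj Ls x y = consecutive x y ∨ (refersTot Ls x y ∨ refersTot Ls y x)

blackAdj : Layers → Vtx → Vtx → Bool
blackAdj Ls x y = consecutive x y ∨ (refersBlk Ls x y ∨ refersBlk Ls y x)

verticesOfLayer : ℕ → List VInfo → List Vtx
verticesOfLayer j L = map (λ p → (j , p)) (upTo (length L))

verticesBelow : Layers → ℕ → List Vtx
verticesBelow Ls i = concat (map (λ j → verticesOfLayer j (layerIn Ls j)) (upTo i))

-- all ordered pairs (B , R) of disjoint subsets of the list N with |B ∪ R| ≤ k,
-- each exactly once; (∅ , ∅) comes first.
pairsUpTo : ℕ → List Vtx → List (List Vtx × List Vtx)
pairsUpTo k [] = [ ([] , []) ]
pairsUpTo zero (x ∷ xs) = pairsUpTo zero xs
pairsUpTo (suc k) (x ∷ xs) =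
  pairsUpTo (suc k) xs
  ++ (map (λ BR → (x ∷ proj₁ BR , proj₂ BR)) (pairsUpTo k xs)
  ++ map (λ BR → (proj₁ BR , x ∷ proj₂ BR)) (pairsUpTo k xs))

Nup : Layers → ℕ → Vtx → List Vtx
Nup Ls i u = filterB (totalAdj Ls u) (verticesBelow Ls i) ++ [ u ]

nextLayer : ℕ → Layers → ℕ → List VInfo
nextLayer t Ls i =
  concat (map (λ p → map (λ BR → vinfo p (proj₁ BR) (proj₂ BR))
                         (pairsUpTo t (Nup Ls i (i , p))))
              (upTo (length (layerIn Ls i))))

layersUpTo : ℕ → ℕ → Layers
layersUpTo t zero = [ [ rootInfo ] ]
layersUpTo t (suc i) = layersUpTo t i ++ [ nextLayer t (layersUpTo t i) i ]

IsVertex : ℕ → Vtx → Set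
IsVertex t (i , p) = p < length (layerIn (layersUpTo t i) i)

WEdge : ℕ → Vtx → Vtx → Set
WEdge t x y = IsVertex t x × IsVertex t y ×
  (blackAdj (layersUpTo t (layerOfV x ⊔ layerOfV y)) x y ≡ true)

IsCliqueW : ℕ → List Vtx → Set
IsCliqueW t K = Unique K × All (IsVertex t) K ×
  (∀ {x y} → x ∈ K → y ∈ K → x ≢ y → WEdge t x y)

{-# OPTIONS --safe #-}
-- Let v be a vertex of the clique K in its highest layer L_m. A black edge at v runs along the path
-- L_m or joins v to its black set B(v), which lies in earlier layers and has at most t elements (an
-- edge created by another vertex w ends in an earlier layer than w's). If v has no path neighbour in
-- K, then K ⊆ {v} ∪ B(v). Otherwise K contains consecutive vertices a, b of L_m, all other vertices
-- of K lie in B(a) ∩ B(b), and it suffices that consecutive vertices of a layer share fewer than t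
-- black neighbours. The children of each parent start with B = ∅, and pairsUpTo (k+1) (x ∷ N) is
-- pairsUpTo (k+1) N, then pairsUpTo k N with x added to each B, then pairsUpTo k N with x added to
-- each R. By induction, neighbours in the enumeration have black sets that are neighbours for
-- budget k, extended by a common x or not at all, except at the seams, where one black set is ∅.
module Submission where

open import Defs
open import Level using (Level)
open import Data.Nat using (ℕ; zero; suc; _≤_; _<_; z≤n; s≤s; _+_)
open import Data.Nat.Properties
  using (_≟_; ≤-refl; <⇒≤; <⇒≢; ≤⇒≯; ≤-pred; m≤n⇒m≤1+n; m≤n⇒m<n∨m≡n; m≤m⊔n; m≤n⊔m;
         +-comm; ≡ᵇ⇒≡; ≡⇒≡ᵇ; module ≤-Reasoning)
open import Data.Bool using (Bool; true; false; T; T?)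
open import Data.Bool.Properties using (T-≡; T-∧; T-∨)
open import Data.Empty using (⊥)
open import Data.Fin using (Fin; zero; suc)
open import Data.Fin.Properties using (injective⇒≤)
open import Data.Product using (_×_; _,_; proj₁; proj₂; ∃)
open import Data.Product.Properties using (≡-dec)
open import Data.Sum using (_⊎_; inj₁; inj₂; [_,_]′)
open import Data.Maybe using (just; nothing; maybe; fromMaybe)
import Data.Maybe as Maybe
import Data.Maybe.Relation.Unary.All as MaybeAll
open import Data.Maybe.Relation.Binary.Connected using (Connected; just; just-nothing; nothing-just; nothing)
open import Data.List using (List; []; _∷_; _++_; [_]; map; concat; upTo; length; filter; head; last; lookup)
open import Data.List.Properties using (length-++; ++-identityʳ; head-map; last-map)
open import Data.List.Membership.Propositional using (_∈_; find; lose)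
open import Data.List.Membership.Propositional.Properties
  using (∈-lookup; ∈-upTo⁻; ∈-filter⁺; ∈-filter⁻)
open import Data.List.Relation.Binary.Subset.Propositional using (_⊆_)
open import Data.List.Relation.Binary.Subset.Propositional.Properties
  using (⊆[]⇒≡[]; ⊆-trans; ⊆∷∧∉⇒⊆; filter-⊆)
open import Data.List.Relation.Unary.All as All using (All; []; _∷_)
import Data.List.Relation.Unary.All.Properties as Allₚ
open import Data.List.Relation.Unary.Any as Any using (Any; here; there; any?)
open import Data.List.Relation.Unary.Any.Properties using (lookup-index; any⁻)
open import Data.List.Relation.Unary.Linked as Linked using (Linked; []; [-]; _∷_)
import Data.List.Relation.Unary.Linked.Properties as Linkedₚ
open import Data.List.Relation.Unary.Unique.Propositional using (Unique; []; _∷_)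
open import Data.List.Relation.Unary.Unique.Propositional.Properties using (filter⁺)
open import Data.List.Extrema.Nat using (argmax; argmax-sel; f[⊥]≤f[argmax]; f[xs]≤f[argmax])
open import Function using (_∘_; _on_; Injective; Equivalence)
open import Relation.Binary.Core using (Rel)
open import Relation.Binary.Definitions using (DecidableEquality)
open import Relation.Binary.PropositionalEquality
  using (_≡_; _≢_; refl; sym; trans; cong; cong₂; subst; module ≡-Reasoning)
open import Relation.Nullary using (¬_; Dec; yes; no; contradiction)
open import Relation.Nullary.Decidable using (¬?; map′)
open import Relation.Unary using (Pred; Decidable)

private
  variable
    α ℓ : Level
    A : Set α

unique-lookup-injective : ∀ {xs : List A} → Unique xs → Injective _≡_ _≡_ (lookup xs)
unique-lookup-injective (_ ∷ _) {zero} {zero} _ = refl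
unique-lookup-injective (x∉xs ∷ _) {zero} {suc j} eq = contradiction eq (All.lookup x∉xs (∈-lookup j))
unique-lookup-injective (x∉xs ∷ _) {suc i} {zero} eq = contradiction (sym eq) (All.lookup x∉xs (∈-lookup i))
unique-lookup-injective (_ ∷ uniq) {suc i} {suc j} eq = cong suc (unique-lookup-injective uniq eq)

unique-⊆⇒length≤ : ∀ {xs ys : List A} → Unique xs → xs ⊆ ys → length xs ≤ length ys
unique-⊆⇒length≤ {xs = xs} {ys} uniq xs⊆ys = injective⇒≤ {f = position} position-injective
  where
  position : Fin (length xs) → Fin (length ys)
  position i = Any.index (xs⊆ys (∈-lookup i))

  lookup-position : ∀ i → lookup xs i ≡ lookup ys (position i)
  lookup-position i = lookup-index (xs⊆ys (∈-lookup i))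

  position-injective : Injective _≡_ _≡_ position
  position-injective {i} {j} eq = unique-lookup-injective uniq (begin
    lookup xs i            ≡⟨ lookup-position i ⟩
    lookup ys (position i) ≡⟨ cong (lookup ys) eq ⟩
    lookup ys (position j) ≡⟨ lookup-position j ⟨
    lookup xs j            ∎)
    where open ≡-Reasoning

-- Counting common elements through duplicate-free sublists lets xs and ys contain repetitions.
SharedFewerThan : ℕ → List A → List A → Set _
SharedFewerThan k xs ys = ∀ zs → Unique zs → zs ⊆ xs → zs ⊆ ys → length zs < k

sharedFewerThan-[]ˡ : ∀ {k} {ys : List A} → SharedFewerThan (suc k) [] ys
sharedFewerThan-[]ˡ zs _ zs⊆[] _ rewrite ⊆[]⇒≡[] zs⊆[] = s≤s z≤n

sharedFewerThan-[]ʳ : ∀ {k} {xs : List A} → SharedFewerThan (suc k) xs []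
sharedFewerThan-[]ʳ zs _ _ zs⊆[] rewrite ⊆[]⇒≡[] zs⊆[] = s≤s z≤n

sharedFewerThan-suc : ∀ {k} {xs ys : List A} → SharedFewerThan k xs ys → SharedFewerThan (suc k) xs ys
sharedFewerThan-suc shared zs uniq zs⊆xs zs⊆ys = m≤n⇒m≤1+n (shared zs uniq zs⊆xs zs⊆ys)

sharedFewerThan-∷ : DecidableEquality A → ∀ {k x} {xs ys : List A} →
  SharedFewerThan k xs ys → SharedFewerThan (suc k) (x ∷ xs) (x ∷ ys)
sharedFewerThan-∷ {A = A} _≟ₐ_ {k} {x} shared zs uniq zs⊆x∷xs zs⊆x∷ys = begin-strict
  length zs        ≤⟨ unique-⊆⇒length≤ uniq zs⊆x∷zs⁻ ⟩
  suc (length zs⁻) <⟨ s≤s (shared zs⁻ (filter⁺ ≢x? uniq) (drop-x zs⊆x∷xs) (drop-x zs⊆x∷ys)) ⟩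
  suc k            ∎
  where
  open ≤-Reasoning
  ≢x? : Decidable (_≢ x)
  ≢x? w = ¬? (w ≟ₐ x)

  zs⁻ : List A
  zs⁻ = filter ≢x? zs

  zs⊆x∷zs⁻ : zs ⊆ x ∷ zs⁻
  zs⊆x∷zs⁻ {w} w∈zs with w ≟ₐ x
  ... | yes w≡x = here w≡x
  ... | no w≢x = there (∈-filter⁺ ≢x? w∈zs w≢x)

  drop-x : ∀ {ws} → zs ⊆ x ∷ ws → zs⁻ ⊆ ws
  drop-x zs⊆x∷ws =
    ⊆∷∧∉⇒⊆ (⊆-trans (filter-⊆ ≢x? zs) zs⊆x∷ws)
           (λ x∈zs⁻ → proj₂ (∈-filter⁻ ≢x? {xs = zs} x∈zs⁻) refl)

head-++ˡ : ∀ (xs : List A) {ys x} → head xs ≡ just x → head (xs ++ ys) ≡ just x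
head-++ˡ (_ ∷ _) eq = eq

last-++ʳ : ∀ (xs : List A) {ys y} → last ys ≡ just y → last (xs ++ ys) ≡ just y
last-++ʳ [] eq = eq
last-++ʳ (_ ∷ []) {[]} ()
last-++ʳ (_ ∷ []) {_ ∷ _} eq = eq
last-++ʳ (_ ∷ x ∷ xs) eq = last-++ʳ (x ∷ xs) eq

module _ {R : Rel A ℓ} where

  connectedˡ : ∀ {mx my a} → mx ≡ just a → (∀ {b} → R a b) → Connected R mx my
  connectedˡ {my = just _} refl aR = just aR
  connectedˡ {my = nothing} refl _ = just-nothing

  connectedʳ : ∀ {mx my b} → my ≡ just b → (∀ {a} → R a b) → Connected R mx my
  connectedʳ {mx = just _} refl Rb = just Rb
  connectedʳ {mx = nothing} refl _ = nothing-just

  linked-concat : ∀ {xss} → All (Linked R) xss →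
    All (λ xs → ∃ λ b → head xs ≡ just b × (∀ {a} → R a b)) xss → Linked R (concat xss)
  linked-concat [] [] = []
  linked-concat {xs ∷ []} (linked ∷ []) _ = subst (Linked R) (sym (++-identityʳ xs)) linked
  linked-concat {_ ∷ ys ∷ _} (linked ∷ linkeds) (_ ∷ heads@((_ , head≡b , Rb) ∷ _)) =
    Linkedₚ.++⁺ linked (connectedʳ (head-++ˡ ys head≡b) Rb) (linked-concat linkeds heads)

lookupM-connected : ∀ {B : Set} {R : Rel B ℓ} {xs} → Linked R xs → ∀ j →
  Connected R (lookupM xs j) (lookupM xs (suc j))
lookupM-connected [] _ = nothing
lookupM-connected [-] zero = just-nothing
lookupM-connected [-] (suc _) = nothing
lookupM-connected (aRb ∷ _) zero = just aRb
lookupM-connected (_ ∷ linked) (suc j) = lookupM-connected linked j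

lookupM-All : ∀ {B : Set} {P : Pred B ℓ} {xs} → All P xs → ∀ j → MaybeAll.All P (lookupM xs j)
lookupM-All [] _ = MaybeAll.nothing
lookupM-All (px ∷ _) zero = MaybeAll.just px
lookupM-All (_ ∷ pxs) (suc j) = lookupM-All pxs j

BlackRed : Set
BlackRed = List Vtx × List Vtx

_≟ᵥ_ : DecidableEquality Vtx
_≟ᵥ_ = ≡-dec _≟_ _≟_

withBlack withRed : Vtx → BlackRed → BlackRed
withBlack x BR = x ∷ proj₁ BR , proj₂ BR
withRed x BR = proj₁ BR , x ∷ proj₂ BR

pairsUpTo-head : ∀ k N → head (pairsUpTo k N) ≡ just ([] , [])
pairsUpTo-head k [] = refl
pairsUpTo-head zero (_ ∷ N) = pairsUpTo-head zero N
pairsUpTo-head (suc k) (_ ∷ N) = head-++ˡ (pairsUpTo (suc k) N) (pairsUpTo-head (suc k) N)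

pairsUpTo-last : ∀ k N → ∃ λ R → last (pairsUpTo k N) ≡ just ([] , R)
pairsUpTo-last k [] = [] , refl
pairsUpTo-last zero (_ ∷ N) = pairsUpTo-last zero N
pairsUpTo-last (suc k) (x ∷ N) with R , last≡ ← pairsUpTo-last k N =
  x ∷ R , last-++ʳ (pairsUpTo (suc k) N) (last-++ʳ (map (withBlack x) (pairsUpTo k N)) (begin
    last (map (withRed x) (pairsUpTo k N))        ≡⟨ last-map (withRed x) (pairsUpTo k N) ⟩
    Maybe.map (withRed x) (last (pairsUpTo k N)) ≡⟨ cong (Maybe.map (withRed x)) last≡ ⟩
    just ([] , x ∷ R)                            ∎))
  where open ≡-Reasoning

pairsUpTo-linked : ∀ k N → Linked (SharedFewerThan k on proj₁) (pairsUpTo k N)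
pairsUpTo-linked k [] = [-]
pairsUpTo-linked zero (_ ∷ N) = pairsUpTo-linked zero N
pairsUpTo-linked (suc k) (x ∷ N) =
  Linkedₚ.++⁺ (pairsUpTo-linked (suc k) N)
    (connectedˡ (proj₂ (pairsUpTo-last (suc k) N)) sharedFewerThan-[]ˡ)
    (Linkedₚ.++⁺ (Linkedₚ.map⁺ (Linked.map (sharedFewerThan-∷ _≟ᵥ_) smaller))
      (connectedʳ head-withRed sharedFewerThan-[]ʳ)
      (Linkedₚ.map⁺ (Linked.map sharedFewerThan-suc smaller)))
  where
  smaller = pairsUpTo-linked k N
  head-withRed : head (map (withRed x) (pairsUpTo k N)) ≡ just ([] , x ∷ [])
  head-withRed = trans (head-map {f = withRed x} (pairsUpTo k N)) (cong (Maybe.map (withRed x)) (pairsUpTo-head k N))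

pairsUpTo-black-bounded : ∀ k N →
  All (λ BR → All (_∈ N) (proj₁ BR) × length (proj₁ BR) ≤ k) (pairsUpTo k N)
pairsUpTo-black-bounded k [] = ([] , z≤n) ∷ []
pairsUpTo-black-bounded zero (x ∷ N) =
  All.map (λ (B⊆N , |B|≤0) → All.map there B⊆N , |B|≤0) (pairsUpTo-black-bounded zero N)
pairsUpTo-black-bounded (suc k) (x ∷ N) = Allₚ.++⁺
  (All.map (λ (B⊆N , |B|≤1+k) → All.map there B⊆N , |B|≤1+k) (pairsUpTo-black-bounded (suc k) N))
  (Allₚ.++⁺
    (Allₚ.map⁺ (All.map (λ (B⊆N , |B|≤k) → here refl ∷ All.map there B⊆N , s≤s |B|≤k) smaller))
    (Allₚ.map⁺ (All.map (λ (B⊆N , |B|≤k) → All.map there B⊆N , m≤n⇒m≤1+n |B|≤k) smaller)))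
  where
  smaller = pairsUpTo-black-bounded k N

lookupM-++ˡ : ∀ {B : Set} (xs : List B) {ys j} → j < length xs → lookupM (xs ++ ys) j ≡ lookupM xs j
lookupM-++ˡ (_ ∷ _) {j = zero} _ = refl
lookupM-++ˡ (_ ∷ xs) {j = suc j} (s≤s j<∣xs∣) = lookupM-++ˡ xs j<∣xs∣

lookupM-∷ʳ : ∀ {B : Set} (xs : List B) {y} → lookupM (xs ++ [ y ]) (length xs) ≡ just y
lookupM-∷ʳ [] = refl
lookupM-∷ʳ (_ ∷ xs) = lookupM-∷ʳ xs

layer : ℕ → ℕ → List VInfo
layer t i = layerIn (layersUpTo t i) i

layersUpTo-length : ∀ t i → length (layersUpTo t i) ≡ suc i
layersUpTo-length t zero = refl
layersUpTo-length t (suc i) = begin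
  length (layersUpTo t i ++ [ _ ]) ≡⟨ length-++ (layersUpTo t i) ⟩
  length (layersUpTo t i) + 1      ≡⟨ cong (_+ 1) (layersUpTo-length t i) ⟩
  suc i + 1                        ≡⟨ +-comm (suc i) 1 ⟩
  suc (suc i)                      ∎
  where open ≡-Reasoning

layersUpTo-stable : ∀ t {i M} → i ≤ M → lookupM (layersUpTo t M) i ≡ lookupM (layersUpTo t i) i
layersUpTo-stable t {M = zero} z≤n = refl
layersUpTo-stable t {i} {suc M} i≤1+M with m≤n⇒m<n∨m≡n i≤1+M
... | inj₂ refl = refl
... | inj₁ (s≤s i≤M) = trans
  (lookupM-++ˡ (layersUpTo t M) (subst (i <_) (sym (layersUpTo-length t M)) (s≤s i≤M)))
  (layersUpTo-stable t i≤M)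

layer-suc : ∀ t i → layer t (suc i) ≡ nextLayer t (layersUpTo t i) i
layer-suc t i = cong (fromMaybe [])
  (subst (λ n → lookupM (layersUpTo t (suc i)) n ≡ just (nextLayer t (layersUpTo t i) i))
         (layersUpTo-length t i) (lookupM-∷ʳ (layersUpTo t i)))

childOf : ℕ → BlackRed → VInfo
childOf p BR = vinfo p (proj₁ BR) (proj₂ BR)

layer-linked : ∀ k i → Linked (SharedFewerThan (suc k) on blk) (layer (suc k) i)
layer-linked k zero = [-]
layer-linked k (suc i) = subst (Linked _) (sym (layer-suc (suc k) i))
  (linked-concat (Allₚ.map⁺ (All.universal children-linked parents))
                 (Allₚ.map⁺ (All.universal children-head parents)))
  where
  parents : List ℕ
  parents = upTo (length (layer (suc k) i))

  N : ℕ → List Vtx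
  N p = Nup (layersUpTo (suc k) i) i (i , p)

  children : ℕ → List BlackRed
  children p = pairsUpTo (suc k) (N p)

  children-linked : ∀ p → Linked (SharedFewerThan (suc k) on blk) (map (childOf p) (children p))
  children-linked p = Linkedₚ.map⁺ (pairsUpTo-linked (suc k) (N p))

  children-head : ∀ p → ∃ λ I → head (map (childOf p) (children p)) ≡ just I ×
                                (∀ {J} → SharedFewerThan (suc k) (blk J) (blk I))
  children-head p = vinfo p [] [] ,
    trans (head-map {f = childOf p} (children p))
          (cong (Maybe.map (childOf p)) (pairsUpTo-head (suc k) (N p))) ,
    sharedFewerThan-[]ʳ

Admissible : ℕ → ℕ → List Vtx → Set
Admissible t i B = All (λ y → layerOfV y < i) B × length B ≤ t

All-filterB⁺ : ∀ {P : Pred A ℓ} (f : A → Bool) {xs} → All P xs → All P (filterB f xs)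
All-filterB⁺ f [] = []
All-filterB⁺ f {x ∷ _} (px ∷ pxs) with f x
... | true = px ∷ All-filterB⁺ f pxs
... | false = All-filterB⁺ f pxs

verticesBelow-layer< : ∀ Ls i → All (λ y → layerOfV y < i) (verticesBelow Ls i)
verticesBelow-layer< Ls i =
  Allₚ.concat⁺ (Allₚ.map⁺ (All.tabulate λ j∈i → Allₚ.map⁺ (All.universal (λ _ → ∈-upTo⁻ j∈i) _)))

Nup-layer≤ : ∀ Ls i p → All (λ y → layerOfV y ≤ i) (Nup Ls i (i , p))
Nup-layer≤ Ls i p = Allₚ.++⁺ (All.map <⇒≤ (All-filterB⁺ _ (verticesBelow-layer< Ls i))) (≤-refl ∷ [])

layer-admissible : ∀ t i → All (Admissible t i ∘ blk) (layer t i)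
layer-admissible t zero = ([] , z≤n) ∷ []
layer-admissible t (suc i) = subst (All _) (sym (layer-suc t i))
  (Allₚ.concat⁺ (Allₚ.map⁺ (All.universal children-admissible (upTo (length (layer t i))))))
  where
  children-admissible : ∀ p → All (Admissible t (suc i) ∘ blk)
    (map (childOf p) (pairsUpTo t (Nup (layersUpTo t i) i (i , p))))
  children-admissible p = Allₚ.map⁺ (All.map
    (λ (B⊆N , |B|≤t) → All.map (s≤s ∘ All.lookup (Nup-layer≤ (layersUpTo t i) i p)) B⊆N , |B|≤t)
    (pairsUpTo-black-bounded t (Nup (layersUpTo t i) i (i , p))))

-- A position outside its layer gets the junk black set [], so no lemma below needs IsVertex.
blackSet : ℕ → Vtx → List Vtx
blackSet t (i , p) = maybe blk [] (lookupM (layer t i) p)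

blackSet-admissible : ∀ t x → Admissible t (layerOfV x) (blackSet t x)
blackSet-admissible t (i , p) = maybe-blk (lookupM-All (layer-admissible t i) p)
  where
  maybe-blk : ∀ {mI} → MaybeAll.All (Admissible t i ∘ blk) mI → Admissible t i (maybe blk [] mI)
  maybe-blk (MaybeAll.just admissible) = admissible
  maybe-blk MaybeAll.nothing = [] , z≤n

∈blackSet⇒layer< : ∀ {t x y} → y ∈ blackSet t x → layerOfV y < layerOfV x
∈blackSet⇒layer< {t} {x} = All.lookup (proj₁ (blackSet-admissible t x))

blackSet-consecutive : ∀ k m q → SharedFewerThan (suc k) (blackSet (suc k) (m , q)) (blackSet (suc k) (m , suc q))
blackSet-consecutive k m q = maybe-blk (lookupM-connected (layer-linked k m) q)
  where
  maybe-blk : ∀ {mI mJ} → Connected (SharedFewerThan (suc k) on blk) mI mJ →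
    SharedFewerThan (suc k) (maybe blk [] mI) (maybe blk [] mJ)
  maybe-blk (just shared) = shared
  maybe-blk just-nothing = sharedFewerThan-[]ʳ
  maybe-blk nothing-just = sharedFewerThan-[]ˡ
  maybe-blk nothing = sharedFewerThan-[]ˡ

data Consecutive : Vtx → Vtx → Set where
  next : ∀ {i p} → Consecutive (i , p) (i , suc p)
  prev : ∀ {i p} → Consecutive (i , suc p) (i , p)

consecutive⇒Consecutive : ∀ x y → T (consecutive x y) → Consecutive x y
consecutive⇒Consecutive (i , p) (j , q) h
  with i≡ᵇj , adjacent ← Equivalence.to T-∧ h
  with refl ← ≡ᵇ⇒≡ i j i≡ᵇj
  with Equivalence.to T-∨ adjacent
... | inj₁ p+1≡ᵇq with refl ← ≡ᵇ⇒≡ (suc p) q p+1≡ᵇq = next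
... | inj₂ q+1≡ᵇp with refl ← ≡ᵇ⇒≡ (suc q) p q+1≡ᵇp = prev

Consecutive⇒consecutive : ∀ {x y} → Consecutive x y → T (consecutive x y)
Consecutive⇒consecutive (next {i} {p}) =
  Equivalence.from T-∧ (≡⇒≡ᵇ i i refl , Equivalence.from T-∨ (inj₁ (≡⇒≡ᵇ p p refl)))
Consecutive⇒consecutive (prev {i} {p}) =
  Equivalence.from T-∧ (≡⇒≡ᵇ i i refl , Equivalence.from T-∨ (inj₂ (≡⇒≡ᵇ p p refl)))

consecutive? : ∀ x y → Dec (Consecutive x y)
consecutive? x y = map′ (consecutive⇒Consecutive x y) Consecutive⇒consecutive (T? (consecutive x y))

Consecutive-layer : ∀ {x y} → Consecutive x y → layerOfV x ≡ layerOfV y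
Consecutive-layer next = refl
Consecutive-layer prev = refl

Consecutive-no-triangle : ∀ {m q w} → Consecutive (m , q) w → Consecutive (m , suc q) w → ⊥
Consecutive-no-triangle next ()
Consecutive-no-triangle prev ()

eqV⇒≡ : ∀ x y → T (eqV x y) → x ≡ y
eqV⇒≡ (i , p) (j , q) h with i≡ᵇj , p≡ᵇq ← Equivalence.to T-∧ h =
  cong₂ _,_ (≡ᵇ⇒≡ i j i≡ᵇj) (≡ᵇ⇒≡ p q p≡ᵇq)

elemB⇒∈ : ∀ y xs → T (elemB y xs) → y ∈ xs
elemB⇒∈ y xs h = Any.map (eqV⇒≡ y _) (any⁻ (eqV y) xs h)

refersBlk⇒∈blackSet : ∀ t {M} x y → layerOfV x ≤ M → T (refersBlk (layersUpTo t M) x y) →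
  y ∈ blackSet t x
refersBlk⇒∈blackSet t {M} (i , p) y i≤M h =
  subst (λ Lᵢ → y ∈ maybe blk [] (lookupM (fromMaybe [] Lᵢ) p)) (layersUpTo-stable t i≤M)
        (elem-maybe (infoOf (layersUpTo t M) (i , p)) h)
  where
  elem-maybe : ∀ mI → T (maybe (λ I → elemB y (blk I)) false mI) → y ∈ maybe blk [] mI
  elem-maybe (just I) = elemB⇒∈ y (blk I)

WEdge-cases : ∀ {t x y} → WEdge t x y → Consecutive x y ⊎ y ∈ blackSet t x ⊎ x ∈ blackSet t y
WEdge-cases {t} {x} {y} (_ , _ , adjacent) with Equivalence.to T-∨ (Equivalence.from T-≡ adjacent)
... | inj₁ x~y = inj₁ (consecutive⇒Consecutive x y x~y)
... | inj₂ refers with Equivalence.to T-∨ refers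
...   | inj₁ x→y = inj₂ (inj₁ (refersBlk⇒∈blackSet t x y (m≤m⊔n (layerOfV x) (layerOfV y)) x→y))
...   | inj₂ y→x = inj₂ (inj₂ (refersBlk⇒∈blackSet t y x (m≤n⊔m (layerOfV x) (layerOfV y)) y→x))

WEdge-downward : ∀ {t x y} → WEdge t x y → layerOfV y ≤ layerOfV x → Consecutive x y ⊎ y ∈ blackSet t x
WEdge-downward edge y≤x with WEdge-cases edge
... | inj₁ x~y = inj₁ x~y
... | inj₂ (inj₁ y∈Bx) = inj₂ y∈Bx
... | inj₂ (inj₂ x∈By) = contradiction (∈blackSet⇒layer< x∈By) (≤⇒≯ y≤x)

common-neighbour-∈blackSets : ∀ {t m q w} → WEdge t (m , q) w → WEdge t (m , suc q) w → layerOfV w ≤ m →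
  w ∈ blackSet t (m , q) × w ∈ blackSet t (m , suc q)
common-neighbour-∈blackSets edgeᵃ edgeᵇ w≤m with WEdge-downward edgeᵃ w≤m | WEdge-downward edgeᵇ w≤m
... | inj₂ w∈Bᵃ | inj₂ w∈Bᵇ = w∈Bᵃ , w∈Bᵇ
... | inj₁ a~w | inj₁ b~w = contradiction b~w (Consecutive-no-triangle a~w)
... | inj₁ a~w | inj₂ w∈Bᵇ = contradiction (sym (Consecutive-layer a~w)) (<⇒≢ (∈blackSet⇒layer< w∈Bᵇ))
... | inj₂ w∈Bᵃ | inj₁ b~w = contradiction (sym (Consecutive-layer b~w)) (<⇒≢ (∈blackSet⇒layer< w∈Bᵃ))

clique-length-lone-top : ∀ {t K v} → IsCliqueW t K → v ∈ K → All (λ w → layerOfV w ≤ layerOfV v) K →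
  ¬ Any (Consecutive v) K → length K ≤ suc t
clique-length-lone-top {t} {K} {v} (uniq , _ , edge) v∈K below no-consecutive = begin
  length K                     ≤⟨ unique-⊆⇒length≤ uniq K⊆v∷Bᵛ ⟩
  suc (length (blackSet t v))  ≤⟨ s≤s (proj₂ (blackSet-admissible t v)) ⟩
  suc t                        ∎
  where
  open ≤-Reasoning
  K⊆v∷Bᵛ : K ⊆ v ∷ blackSet t v
  K⊆v∷Bᵛ {w} w∈K with w ≟ᵥ v
  ... | yes w≡v = here w≡v
  ... | no w≢v with WEdge-downward (edge v∈K w∈K (w≢v ∘ sym)) (All.lookup below w∈K)
  ...   | inj₁ v~w = contradiction (lose w∈K v~w) no-consecutive
  ...   | inj₂ w∈Bᵛ = there w∈Bᵛ

clique-length-consecutive : ∀ {k K m q} → IsCliqueW (suc k) K → (m , q) ∈ K → (m , suc q) ∈ K →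
  All (λ w → layerOfV w ≤ m) K → length K ≤ suc (suc k)
clique-length-consecutive {k} {K} {m} {q} (uniq , _ , edge) a∈K b∈K below =
  ≤-pred (shared K uniq (K⊆a∷b∷ (λ w∈K w≢a w≢b → proj₁ (common w∈K w≢a w≢b)))
                         (K⊆a∷b∷ (λ w∈K w≢a w≢b → proj₂ (common w∈K w≢a w≢b))))
  where
  a b : Vtx
  a = m , q
  b = m , suc q

  shared : SharedFewerThan (suc (suc (suc k))) (a ∷ b ∷ blackSet (suc k) a) (a ∷ b ∷ blackSet (suc k) b)
  shared = sharedFewerThan-∷ _≟ᵥ_ (sharedFewerThan-∷ _≟ᵥ_ (blackSet-consecutive k m q))

  common : ∀ {w} → w ∈ K → w ≢ a → w ≢ b → w ∈ blackSet (suc k) a × w ∈ blackSet (suc k) b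
  common w∈K w≢a w≢b =
    common-neighbour-∈blackSets (edge a∈K w∈K (w≢a ∘ sym)) (edge b∈K w∈K (w≢b ∘ sym))
                                (All.lookup below w∈K)

  K⊆a∷b∷ : ∀ {B} → (∀ {w} → w ∈ K → w ≢ a → w ≢ b → w ∈ B) → K ⊆ a ∷ b ∷ B
  K⊆a∷b∷ into {w} w∈K with w ≟ᵥ a | w ≟ᵥ b
  ... | yes w≡a | _ = here w≡a
  ... | no _ | yes w≡b = there (here w≡b)
  ... | no w≢a | no w≢b = there (there (into w∈K w≢a w≢b))

clique-length-top : ∀ {k K v} → IsCliqueW (suc k) K → v ∈ K → All (λ w → layerOfV w ≤ layerOfV v) K →
  length K ≤ suc (suc k)
clique-length-top {K = K} {v} clique v∈K below with any? (consecutive? v) K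
... | no no-consecutive = clique-length-lone-top clique v∈K below no-consecutive
... | yes has-consecutive with find has-consecutive
...   | _ , w∈K , next = clique-length-consecutive clique v∈K w∈K below
...   | _ , w∈K , prev = clique-length-consecutive clique w∈K v∈K below

mainTheorem10 : (t : ℕ) → 1 ≤ t →
    (X : List Vtx) → Unique X → All (IsVertex t) X →
    (K : List Vtx) → All (_∈ X) K → IsCliqueW t K →
    length K ≤ suc t
mainTheorem10 (suc k) _ _ _ _ [] _ _ = z≤n
mainTheorem10 (suc k) _ _ _ _ (w ∷ ws) _ clique = clique-length-top clique top∈K below
  where
  top : Vtx
  top = argmax layerOfV w ws

  top∈K : top ∈ w ∷ ws
  top∈K = [ here , there ]′ (argmax-sel layerOfV w ws)

  below : All (λ v → layerOfV v ≤ layerOfV top) (w ∷ ws)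
  below = f[⊥]≤f[argmax] {f = layerOfV} w ws ∷ f[xs]≤f[argmax] w ws
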